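{- For every ${\bf\Sigma}^1_1$ (analytic) set $A\subseteq\omega^\omega$, either there exists a Hechler tree $H$ with $[H]\cap A=\emptyset$, or there exists a Laver tree $L$ with $[L]\subseteq A$.
   Context: A subtree of $\omega^{<\omega}$ is a nonempty subset closed under initial segments. For $s\in\omega^{<\omega}$ and $n\in\omega$, $sn$ denotes the one-term extension of $s$ by $n$. A subtree $H\subseteq\omega^{<\omega}$ is Hechler iff for every $s\in H$, $sn\in H$ for all but finitely many $n\in\omega$. A subtree $L\subseteq\omega^{<\omega}$ is Laver iff for every $s\in L$, $sn\in L$ for infinitely many $n\in\omega$. For a subtree $T$, $[T]=\{x\in\omega^\omega: \forall n\ x\upharpoonright n\in T\}$. -}

module Defs where

open import Data.Nat using (ℕ; _≤_)
open import Data.List using (List; []; _++_; _∷ʳ_; applyUpTo; zip)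
open import Data.Product using (Σ; _×_; _,_; ∃)
open import Relation.Nullary using (¬_; Dec)
open import Function.Bundles using (_⇔_)

-- Finite sequences ω^{<ω} are lists of naturals; s n (one-term extension) is s ∷ʳ n.
Seq : Set
Seq = List ℕ

Baire : Set
Baire = ℕ → ℕ

_↾_ : Baire → ℕ → Seq
x ↾ n = applyUpTo x n

SeqSet : Set₁
SeqSet = Seq → Set

BaireSet : Set₁
BaireSet = Baire → Set

record IsSubtree (T : SeqSet) : Set where
  field
    nonempty : Σ Seq T
    closed   : ∀ s t → T (s ++ t) → T s

IsHechler : SeqSet → Set
IsHechler H = IsSubtree H × (∀ s → H s → Σ ℕ λ N → ∀ n → N ≤ n → H (s ∷ʳ n))

IsLaver : SeqSet → Set
IsLaver L = IsSubtree L × (∀ s → L s → ∀ m → Σ ℕ λ n → m ≤ n × L (s ∷ʳ n))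

[_] : SeqSet → BaireSet
[ T ] x = ∀ n → T (x ↾ n)

-- analytic (Σ^1_1): projection of a closed subset of ω^ω × ω^ω,
-- i.e. A = { x | ∃ y ∀ n, (x↾n , y↾n) ∈ S } for some S ⊆ (ω×ω)^{<ω}
IsAnalytic : BaireSet → Set₁
IsAnalytic A = Σ (List (ℕ × ℕ) → Set) λ S →
  ∀ x → A x ⇔ (Σ Baire λ y → ∀ n → S (zip (x ↾ n) (y ↾ n)))

ExcludedMiddle : Set₁
ExcludedMiddle = (P : Set) → Dec P

-- A derivation of Refuted s t is a well-founded certificate that the Hechler player defeats
-- every attempt to extend s to a point x ∈ A together with a witness y extending t.
-- If the empty pair is refuted, a single Hechler tree H dominates the finitely many positions
-- of the certificate that are compatible with each node; a branch of H carrying a witness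
-- would then follow the certificate forever, against well-foundedness.  If it is not refuted,
-- excluded middle turns the absence of a certificate into a Laver rank leading to a node where
-- the next witness value can be revealed without becoming refutable; the Laver tree L follows
-- these ranks, and along every branch of L the revealed values converge to a witness.
module Submission where

open import Defs
open import Data.Bool using (Bool; true; false; T)
open import Data.Empty using (⊥)
open import Data.List using (List; []; _∷_; _++_; _∷ʳ_; applyUpTo; zip; length; map; concatMap; foldl; upTo)
open import Data.List.Properties
  using (++-assoc; ++-identityʳ; ∷-injective; length-++; length-applyUpTo; applyUpTo-∷ʳ; foldl-∷ʳ; foldl-++)
open import Data.List.Membership.Propositional using (_∈_; lose)
open import Data.List.Membership.Propositional.Properties using (∈-map⁺; ∈-concatMap⁺; ∈-upTo⁺)
open import Data.List.Relation.Unary.Any using (here; there)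
open import Data.Maybe using (Maybe; just; nothing; _>>=_)
open import Data.Maybe.Properties using (just-injective)
open import Data.Nat using (ℕ; zero; suc; _≤_; _<_; _⊓_; _+_; _∸_; z≤n; s≤s; z<s; s<s; _≤?_)
open import Data.Nat.ListAction using (sum)
open import Data.Nat.Properties
open import Data.Product using (Σ; ∃; _×_; _,_; proj₁; proj₂)
open import Data.Sum using (_⊎_; inj₁; inj₂)
open import Data.Unit using (⊤; tt)
open import Function using (_∘_)
open import Function.Bundles using (Equivalence)
open import Relation.Nullary using (¬_; Dec; yes; no; contradiction)
open import Relation.Nullary.Decidable using (⌊_⌋; toWitness; fromWitness; decidable-stable)
open import Relation.Binary.PropositionalEquality
  using (_≡_; refl; sym; trans; cong; cong₂; subst; module ≡-Reasoning)

∈⇒≤sum : ∀ {n ns} → n ∈ ns → n ≤ sum ns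
∈⇒≤sum {ns = m ∷ ns} (here refl)  = m≤m+n m (sum ns)
∈⇒≤sum {ns = m ∷ ns} (there n∈ns) = ≤-trans (∈⇒≤sum n∈ns) (m≤n+m (sum ns) m)

length-∷ʳ : ∀ (s : Seq) n → length (s ∷ʳ n) ≡ suc (length s)
length-∷ʳ s n = trans (length-++ s) (+-comm (length s) 1)

length-∷ʳ-≤ : ∀ (s t u : Seq) {m n} → length t ≤ length s → length (t ∷ʳ m) ≤ length (s ++ (u ∷ʳ n))
length-∷ʳ-≤ s t u {m} {n} t≤s = begin
  length (t ∷ʳ m)             ≡⟨ length-∷ʳ t m ⟩
  suc (length t)              ≤⟨ s≤s (≤-trans t≤s (m≤m+n (length s) (length u))) ⟩
  suc (length s + length u)   ≡⟨ +-suc (length s) (length u) ⟨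
  length s + suc (length u)   ≡⟨ cong (length s +_) (length-∷ʳ u n) ⟨
  length s + length (u ∷ʳ n)  ≡⟨ length-++ s ⟨
  length (s ++ (u ∷ʳ n))      ∎
  where open ≤-Reasoning

↾-prefix : ∀ (x : Baire) s {u} k → s ++ u ≡ x ↾ k → s ≡ x ↾ length s
↾-prefix x []      k       _  = refl
↾-prefix x (a ∷ s) zero    ()
↾-prefix x (a ∷ s) (suc k) eq with ∷-injective eq
... | refl , eq′ = cong (a ∷_) (↾-prefix (x ∘ suc) s k eq′)

↾-∷ʳ : ∀ (x : Baire) s {u} k → s ++ u ≡ x ↾ k → s ++ (u ∷ʳ x k) ≡ x ↾ suc k
↾-∷ʳ x s {u} k eq = begin
  s ++ (u ∷ʳ x k)   ≡⟨ ++-assoc s u (x k ∷ []) ⟨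
  (s ++ u) ∷ʳ x k   ≡⟨ cong (_∷ʳ x k) eq ⟩
  (x ↾ k) ∷ʳ x k    ≡⟨ applyUpTo-∷ʳ x k ⟩
  x ↾ suc k         ∎
  where open ≡-Reasoning

zip-applyUpTo : ∀ {A B : Set} (f : ℕ → A) (g : ℕ → B) a b →
                zip (applyUpTo f a) (applyUpTo g b) ≡ applyUpTo (λ i → f i , g i) (a ⊓ b)
zip-applyUpTo f g zero    b       = refl
zip-applyUpTo f g (suc a) zero    = refl
zip-applyUpTo f g (suc a) (suc b) = cong ((f 0 , g 0) ∷_) (zip-applyUpTo (f ∘ suc) (g ∘ suc) a b)

zip-↾ : ∀ (x y : Baire) {s u t} k → s ++ u ≡ x ↾ k → t ≡ y ↾ length t → length t ≤ length s →
        zip s t ≡ zip (x ↾ length t) (y ↾ length t)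
zip-↾ x y {s} {u} {t} k xs yt t≤s = begin
  zip s t                                              ≡⟨ cong₂ zip (↾-prefix x s k xs) yt ⟩
  zip (x ↾ length s) (y ↾ length t)                    ≡⟨ zip-applyUpTo x y (length s) (length t) ⟩
  applyUpTo (λ i → x i , y i) (length s ⊓ length t)    ≡⟨ cong (applyUpTo _) (m≥n⇒m⊓n≡n t≤s) ⟩
  applyUpTo (λ i → x i , y i) (length t)               ≡⟨ cong (applyUpTo _) (⊓-idem (length t)) ⟨
  applyUpTo (λ i → x i , y i) (length t ⊓ length t)    ≡⟨ zip-applyUpTo x y (length t) (length t) ⟨
  zip (x ↾ length t) (y ↾ length t)                    ∎
  where open ≡-Reasoning

_⊑_ : Seq → Seq → Set
s ⊑ t = ∃ λ d → t ≡ s ++ d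

⊑-trans : ∀ {s t v} → s ⊑ t → t ⊑ v → s ⊑ v
⊑-trans {s} (d , refl) (e , refl) = d ++ e , ++-assoc s d e

-- The i-th entry of a finite sequence, with junk value 0 beyond its length.
at : Seq → ℕ → ℕ
at []      i       = 0
at (a ∷ s) zero    = a
at (a ∷ s) (suc i) = at s i

at-⊑ : ∀ {s t} i → s ⊑ t → i < length s → at s i ≡ at t i
at-⊑ {a ∷ s} zero    (d , refl) _          = refl
at-⊑ {a ∷ s} (suc i) (d , refl) (s≤s i<s) = at-⊑ {s} i (d , refl) i<s

↾-at : ∀ (y : Baire) s → (∀ i → i < length s → at s i ≡ y i) → s ≡ y ↾ length s
↾-at y []      _ = refl
↾-at y (a ∷ s) h = cong₂ _∷_ (h 0 z<s) (↾-at (y ∘ suc) s (λ i i<s → h (suc i) (s<s i<s)))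

chain-limit : (c : ℕ → Seq) → (∀ k → c k ⊑ c (suc k)) → (∀ j → ∃ λ k → j < length (c k)) →
              Σ Baire λ y → ∀ k → c k ≡ y ↾ length (c k)
chain-limit c grows long = y , λ k → ↾-at y (c k) (λ i i<c → agree i i<c (proj₂ (long i)))
  where
  y : Baire
  y j = at (c (proj₁ (long j))) j

  ⊑-+ : ∀ k d → c k ⊑ c (d + k)
  ⊑-+ k zero    = [] , sym (++-identityʳ (c k))
  ⊑-+ k (suc d) = ⊑-trans (⊑-+ k d) (grows (d + k))

  ⊑-mono : ∀ {k k'} → k ≤ k' → c k ⊑ c k'
  ⊑-mono {k} {k'} k≤k' = subst (λ z → c k ⊑ c z) (m∸n+n≡m k≤k') (⊑-+ k (k' ∸ k))

  agree : ∀ {k k'} i → i < length (c k) → i < length (c k') → at (c k) i ≡ at (c k') i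
  agree {k} {k'} i i<c i<c' with ≤-total k k'
  ... | inj₁ k≤k' = at-⊑ i (⊑-mono k≤k') i<c
  ... | inj₂ k'≤k = sym (at-⊑ i (⊑-mono k'≤k) i<c')

growing⇒unbounded : (ℓ : ℕ → ℕ) → (∀ k → ∃ λ k' → ℓ k < ℓ k') → ∀ j → ∃ λ k → j ≤ ℓ k
growing⇒unbounded ℓ grows zero = 0 , z≤n
growing⇒unbounded ℓ grows (suc j) with growing⇒unbounded ℓ grows j
... | k , j≤ℓk with grows k
...   | k' , ℓk<ℓk' = k' , ≤-trans (s≤s j≤ℓk) ℓk<ℓk'

attains : (ℓ : ℕ → ℕ) → ℓ 0 ≡ 0 → (∀ k → ℓ (suc k) ≤ suc (ℓ k)) →
          ∀ {j} k → j ≤ ℓ k → ∃ λ k' → ℓ k' ≡ j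
attains ℓ ℓ0 step zero j≤ℓ0 = 0 , trans ℓ0 (sym (n≤0⇒n≡0 (subst (_ ≤_) ℓ0 j≤ℓ0)))
attains ℓ ℓ0 step {j} (suc k) j≤ℓk+1 with j ≤? ℓ k
... | yes j≤ℓk = attains ℓ ℓ0 step k j≤ℓk
... | no  j≰ℓk = suc k , ≤-antisym (≤-trans (step k) (≰⇒> j≰ℓk)) j≤ℓk+1

-- Above g [] is the Hechler tree in which the children of a node s are the s ∷ʳ n with n ≥ g s;
-- the accumulator a is the part of the node already read.
Above : (Seq → ℕ) → Seq → Seq → Set
Above g a []      = ⊤
Above g a (n ∷ b) = g a ≤ n × Above g (a ∷ʳ n) b

Above-∷ʳ⁺ : ∀ g a b {n} → Above g a b → g (a ++ b) ≤ n → Above g a (b ∷ʳ n)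
Above-∷ʳ⁺ g a []      {n} _          ga≤n = subst (λ z → g z ≤ n) (++-identityʳ a) ga≤n , tt
Above-∷ʳ⁺ g a (m ∷ b) {n} (ga≤m , h) le   =
  ga≤m , Above-∷ʳ⁺ g (a ∷ʳ m) b h (subst (λ z → g z ≤ n) (sym (++-assoc a (m ∷ []) b)) le)

Above-∷ʳ⁻ : ∀ g a b {n} → Above g a (b ∷ʳ n) → g (a ++ b) ≤ n
Above-∷ʳ⁻ g a []      {n} (ga≤n , _) = subst (λ z → g z ≤ n) (sym (++-identityʳ a)) ga≤n
Above-∷ʳ⁻ g a (m ∷ b) {n} (_ , h)    =
  subst (λ z → g z ≤ n) (++-assoc a (m ∷ []) b) (Above-∷ʳ⁻ g (a ∷ʳ m) b h)

Above-++⁻ : ∀ g a b c → Above g a (b ++ c) → Above g a b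
Above-++⁻ g a []      c _          = tt
Above-++⁻ g a (m ∷ b) c (ga≤m , h) = ga≤m , Above-++⁻ g (a ∷ʳ m) b c h

Above-preserves : ∀ g (P : Seq → Set) → (∀ {a n} → P a → g a ≤ n → P (a ∷ʳ n)) →
                  ∀ a b → Above g a b → P a → P (a ++ b)
Above-preserves g P step a []      _          Pa = subst P (sym (++-identityʳ a)) Pa
Above-preserves g P step a (m ∷ b) (ga≤m , h) Pa =
  subst P (++-assoc a (m ∷ []) b) (Above-preserves g P step (a ∷ʳ m) b h (step Pa ga≤m))

Above-isHechler : ∀ g → IsHechler (Above g [])
Above-isHechler g = record { nonempty = [] , tt ; closed = Above-++⁻ g [] }
                  , λ s s∈ → g s , λ n gs≤n → Above-∷ʳ⁺ g [] s s∈ gs≤n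

module Game (S : List (ℕ × ℕ) → Set) where

  Along : Baire → Baire → Set
  Along x y = ∀ n → S (zip (x ↾ n) (y ↾ n))

  -- Positions pair a node s for x with a node t, |t| ≤ |s|, for its witness y.  The Hechler
  -- player either sees S fail already, or commits to the tree of g above s: whenever x leaves
  -- s through u within that tree and then plays n ≥ g u, every next witness value m is refuted.
  data Refuted (s t : Seq) : Set
  Outrun : Seq → Seq → (Seq → ℕ) → Set

  Outrun s t g = ∀ u → Above g [] u → ∀ n → g u ≤ n → ∀ m → Refuted (s ++ (u ∷ʳ n)) (t ∷ʳ m)

  data Refuted s t where
    violated : ¬ S (zip s t) → Refuted s t
    outrun   : (g : Seq → ℕ) → Outrun s t g → Refuted s t

  module HechlerSide (root : Refuted [] []) where

    Within : ∀ {s t} → Refuted s t → Seq → Set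
    Within (violated _) u = ⊤
    Within (outrun g _) u = Above g [] u

    Within-[] : ∀ {s t} (w : Refuted s t) → Within w []
    Within-[] (violated _) = tt
    Within-[] (outrun g _) = tt

    record Position : Set where
      constructor position
      field
        {s t}  : Seq
        proof  : Refuted s t
        u      : Seq
        within : Within proof u

    start : ∀ {s t} → Refuted s t → Position
    start w = position w [] (Within-[] w)

    demand : Position → ℕ
    demand (position (violated _) _ _) = 0
    demand (position (outrun g _) u _) = g u

    -- Witness values are only revealed up to the current value n of x: this keeps the set of
    -- positions finite, and x k ≥ k guarantees that each witness value is eventually revealed.
    moves : Position → ℕ → List Position
    moves (position (violated _) _ _) n = []
    moves (position {s} {t} (outrun g p) u a) n with g u ≤? n
    ... | yes gu≤n = position {s} {t} (outrun g p) (u ∷ʳ n) (Above-∷ʳ⁺ g [] u a gu≤n)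
                   ∷ map (λ m → start (p u a n gu≤n m)) (upTo (suc n))
    ... | no  _    = []

    moves-stay : ∀ {s t} g (p : Outrun s t g) u (a : Above g [] u) n → g u ≤ n →
      ∃ λ a' → position {s} {t} (outrun g p) (u ∷ʳ n) a' ∈ moves (position {s} {t} (outrun g p) u a) n
    moves-stay g p u a n gu≤n with g u ≤? n
    ... | yes _    = _ , here refl
    ... | no  gu≰n = contradiction gu≤n gu≰n

    moves-reveal : ∀ {s t} g (p : Outrun s t g) u (a : Above g [] u) n → g u ≤ n → ∀ m → m ≤ n →
      ∃ λ gu≤n → start (p u a n gu≤n m) ∈ moves (position {s} {t} (outrun g p) u a) n
    moves-reveal g p u a n gu≤n m m≤n with g u ≤? n
    ... | yes gu≤n' = gu≤n' , there (∈-map⁺ (λ m → start (p u a n gu≤n' m)) (∈-upTo⁺ (s≤s m≤n)))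
    ... | no  gu≰n  = contradiction gu≤n gu≰n

    positions : Seq → List Position
    positions = foldl (λ ps n → concatMap (λ p → moves p n) ps) (start root ∷ [])

    positions-↾ : ∀ (x : Baire) k {p p'} → p ∈ positions (x ↾ k) → p' ∈ moves p (x k) →
                  p' ∈ positions (x ↾ suc k)
    positions-↾ x k {p' = p'} p∈ p'∈ =
      subst (p' ∈_) (trans (sym (foldl-∷ʳ _ _ (x k) (x ↾ k))) (cong positions (applyUpTo-∷ʳ x k)))
            (∈-concatMap⁺ (λ p → moves p (x k)) (lose p∈ p'∈))

    bound : Seq → ℕ
    bound s = length s + sum (map demand (positions s))

    H : SeqSet
    H = Above bound []

    module Run (x y : Baire) (along : Along x y) (x∈H : [ H ] x) where

      bound≤x : ∀ k → bound (x ↾ k) ≤ x k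
      bound≤x k = Above-∷ʳ⁻ bound [] (x ↾ k) (subst H (sym (applyUpTo-∷ʳ x k)) (x∈H (suc k)))

      k≤x : ∀ k → k ≤ x k
      k≤x k = ≤-trans (≤-trans (≤-reflexive (sym (length-applyUpTo x k))) (m≤m+n _ _)) (bound≤x k)

      demand≤x : ∀ {p} k → p ∈ positions (x ↾ k) → demand p ≤ x k
      demand≤x k p∈ = ≤-trans (∈⇒≤sum (∈-map⁺ demand p∈)) (≤-trans (m≤n+m _ _) (bound≤x k))

      ↾-reveal : ∀ t → t ≡ y ↾ length t → t ∷ʳ y (length t) ≡ y ↾ length (t ∷ʳ y (length t))
      ↾-reveal t yt = trans (↾-∷ʳ y [] (length t) yt) (cong (y ↾_) (sym (length-∷ʳ t _)))

      refute : ∀ {s t} (w : Refuted s t) u (a : Within w u) k → position w u a ∈ positions (x ↾ k) →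
               s ++ u ≡ x ↾ k → t ≡ y ↾ length t → length t ≤ length s → ⊥
      refute (violated ¬S) u a k _ xs yt t≤s = ¬S (subst S (sym (zip-↾ x y k xs yt t≤s)) (along _))
      refute {s} {t} (outrun g p) u a k p∈ xs yt t≤s = chase (y (length t)) k u a (m≤m+n _ k) p∈ xs
        where
        -- d bounds the number of moves before x exceeds the next witness value.
        chase : ∀ d k u (a : Above g [] u) → y (length t) ≤ d + k →
                position (outrun g p) u a ∈ positions (x ↾ k) → s ++ u ≡ x ↾ k → ⊥
        chase d k u a _ p∈ xs with y (length t) ≤? x k
        ... | yes y≤x with moves-reveal {s} {t} g p u a (x k) (demand≤x k p∈) _ y≤x
        ...   | gu≤x , q∈ = refute (p u a (x k) gu≤x (y (length t))) [] _ (suc k)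
                              (positions-↾ x k p∈ q∈) (trans (++-identityʳ _) (↾-∷ʳ x s k xs))
                              (↾-reveal t yt) (length-∷ʳ-≤ s t u t≤s)
        chase zero    k u a y≤k _  _  | no y≰x = y≰x (≤-trans y≤k (k≤x k))
        chase (suc d) k u a y≤ p∈ xs | no _ with moves-stay {s} {t} g p u a (x k) (demand≤x k p∈)
        ... | a' , q∈ = chase d (suc k) (u ∷ʳ x k) a' (subst (y (length t) ≤_) (sym (+-suc d k)) y≤)
                              (positions-↾ x k p∈ q∈) (↾-∷ʳ x s k xs)

    H-isHechler : IsHechler H
    H-isHechler = Above-isHechler bound

    H-avoids : ∀ x → [ H ] x → ¬ (∃ λ y → Along x y)
    H-avoids x x∈H (y , along) = Run.refute x y along x∈H root [] _ 0 (here refl) refl refl z≤n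

  Revealable : Seq → Seq → Seq → Set
  Revealable s t v = 0 < length v × ∃ λ m → ¬ Refuted (s ++ v) (t ∷ʳ m)

  Infinite : (ℕ → Bool) → Set
  Infinite I = ∀ N → ∃ λ n → N ≤ n × T (I n)

  data Rank (s t : Seq) : Seq → Set where
    revealed  : ∀ {u} → Revealable s t u → Rank s t u
    branching : ∀ {u} (I : ℕ → Bool) → Infinite I → (∀ n → T (I n) → Rank s t (u ∷ʳ n)) → Rank s t u

  data _⟶[_]_ : Seq × Seq × Seq → ℕ → Seq × Seq × Seq → Set where
    stay   : ∀ {s t u n}   → (s , t , u) ⟶[ n ] (s , t , u ∷ʳ n)
    reveal : ∀ {s t u n m} → (s , t , u) ⟶[ n ] (s ++ (u ∷ʳ n) , t ∷ʳ m , [])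

  ⟶-position : ∀ {s t u n s' t' u'} → (s , t , u) ⟶[ n ] (s' , t' , u') → s' ++ u' ≡ (s ++ u) ∷ʳ n
  ⟶-position {s} {u = u} {n} stay   = sym (++-assoc s u (n ∷ []))
  ⟶-position {s} {u = u} {n} reveal = trans (++-identityʳ _) (sym (++-assoc s u (n ∷ [])))

  ⟶-lag : ∀ {s t u n s' t' u'} → (s , t , u) ⟶[ n ] (s' , t' , u') →
          length t ≤ length s → length t' ≤ length s'
  ⟶-lag               stay   t≤s = t≤s
  ⟶-lag {s} {t} {u}   reveal t≤s = length-∷ʳ-≤ s t u t≤s

  ⟶-extends : ∀ {s t u n s' t' u'} → (s , t , u) ⟶[ n ] (s' , t' , u') → t ⊑ t'
  ⟶-extends {t = t} stay       = [] , sym (++-identityʳ t)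
  ⟶-extends (reveal {m = m})   = m ∷ [] , refl

  ⟶-length : ∀ {s t u n s' t' u'} → (s , t , u) ⟶[ n ] (s' , t' , u') → length t' ≤ suc (length t)
  ⟶-length {t = t} stay            = n≤1+n (length t)
  ⟶-length {t = t} (reveal {m = m}) = ≤-reflexive (length-∷ʳ t m)

  module LaverSide (em : ExcludedMiddle) (root : ¬ Refuted [] []) where

    ¬Refuted⇒S : ∀ {s t} → ¬ Refuted s t → S (zip s t)
    ¬Refuted⇒S ¬w = decidable-stable (em _) (¬w ∘ violated)

    module _ {s t : Seq} where

      Sparse : Seq → Set
      Sparse a = ∃ λ N → ∀ n → N ≤ n → ¬ Rank s t (a ∷ʳ n)

      threshold : Seq → ℕ
      threshold a with em (Sparse a)
      ... | yes (N , _) = N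
      ... | no  _       = 0

      ¬Sparse⇒Rank : ∀ {a} → ¬ Sparse a → Rank s t a
      ¬Sparse⇒Rank {a} dense = branching (λ n → ⌊ em (Rank s t (a ∷ʳ n)) ⌋) infinite (λ n → toWitness)
        where
        infinite : Infinite (λ n → ⌊ em (Rank s t (a ∷ʳ n)) ⌋)
        infinite N with em (∃ λ n → N ≤ n × Rank s t (a ∷ʳ n))
        ... | yes (n , N≤n , r) = n , N≤n , fromWitness r
        ... | no  none          = contradiction (N , λ n N≤n r → none (n , N≤n , r)) dense

      unranked-∷ʳ : ∀ {a n} → ¬ Rank s t a → threshold a ≤ n → ¬ Rank s t (a ∷ʳ n)
      unranked-∷ʳ {a} {n} ¬r ta≤n with em (Sparse a)
      ... | yes (_ , sparse) = sparse n ta≤n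
      ... | no  dense        = contradiction (¬Sparse⇒Rank dense) ¬r

      -- If [] had no rank, the threshold function would outrun (s, t).
      ¬Refuted⇒Rank : ¬ Refuted s t → Rank s t []
      ¬Refuted⇒Rank ¬w with em (Rank s t [])
      ... | yes r  = r
      ... | no  ¬r = contradiction (outrun threshold refute) ¬w
        where
        refute : Outrun s t threshold
        refute u a n tu≤n m = decidable-stable (em _) λ ¬w' →
          unranked-∷ʳ (Above-preserves threshold (λ v → ¬ Rank s t v) unranked-∷ʳ [] u a ¬r) tu≤n
            (revealed (subst (0 <_) (sym (length-∷ʳ u n)) z<s , m , ¬w'))

    -- The branch read so far is s ++ u: t was revealed along s, and u has not yet reached a
    -- revealable node.
    record State : Set where
      constructor state
      field
        {s t u}    : Seq
        unrefuted  : ¬ Refuted s t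
        rank       : Rank s t u
        unrevealed : ¬ Revealable s t u

    open State

    config : State → Seq × Seq × Seq
    config st = s st , t st , u st

    restart : ∀ {s t} → ¬ Refuted s t → State
    restart ¬w = state ¬w (¬Refuted⇒Rank ¬w) λ ()

    enter : ∀ {s t u} → ¬ Refuted s t → Rank s t u → Dec (Revealable s t u) → State
    enter _  _ (yes (_ , _ , ¬w')) = restart ¬w'
    enter ¬w r (no  ¬rv)          = state ¬w r ¬rv

    stepWith : ∀ {s t u} → ¬ Refuted s t → (b : Bool) → (T b → Rank s t u) → Maybe State
    stepWith ¬w true  child = just (enter ¬w (child tt) (em _))
    stepWith ¬w false child = nothing

    step : State → ℕ → Maybe State
    step (state _  (revealed rv)             ¬rv) n = contradiction rv ¬rv
    step (state ¬w (branching I _ children) _)   n = stepWith ¬w (I n) (children n)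

    stepWith-just : ∀ {s t u} {¬w : ¬ Refuted s t} b {child : T b → Rank s t u} {st'} →
                    stepWith ¬w b child ≡ just st' → Σ (T b) λ i → enter ¬w (child i) (em _) ≡ st'
    stepWith-just true refl = tt , refl

    stepWith-T : ∀ {s t u} {¬w : ¬ Refuted s t} b {child : T b → Rank s t u} (i : T b) →
                 stepWith ¬w b child ≡ just (enter ¬w (child i) (em _))
    stepWith-T true tt = refl

    step-⟶ : ∀ st n {st'} → step st n ≡ just st' → config st ⟶[ n ] config st'
    step-⟶ (state _ (revealed rv) ¬rv) n _ = contradiction rv ¬rv
    step-⟶ (state {s} {t} {u} _ (branching I _ _) _) n e with stepWith-just (I n) e
    ... | i , refl with em (Revealable s t (u ∷ʳ n))
    ...   | yes _ = reveal
    ...   | no  _ = stay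

    advance : Maybe State → ℕ → Maybe State
    advance st n = st >>= λ st → step st n

    walk : Seq → Maybe State
    walk = foldl advance (just (restart root))

    walk-∷ʳ : ∀ s {st} n → walk s ≡ just st → walk (s ∷ʳ n) ≡ step st n
    walk-∷ʳ s n e = trans (foldl-∷ʳ advance _ n s) (cong (λ st → advance st n) e)

    advance-nothing : ∀ v → foldl advance nothing v ≡ nothing
    advance-nothing []      = refl
    advance-nothing (_ ∷ v) = advance-nothing v

    walk-nothing : ∀ s v → walk s ≡ nothing → walk (s ++ v) ≡ nothing
    walk-nothing s v e =
      trans (foldl-++ advance _ s v) (trans (cong (λ σ → foldl advance σ v) e) (advance-nothing v))

    L : SeqSet
    L s = ∃ λ st → walk s ≡ just st

    L-closed : ∀ s v → L (s ++ v) → L s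
    L-closed s v (_ , e) with walk s in e₀
    ... | just st = st , refl
    ... | nothing = contradiction (trans (sym e) (walk-nothing s v e₀)) λ ()

    L-isLaver : IsLaver L
    L-isLaver = record { nonempty = [] , restart root , refl ; closed = L-closed } , splits
      where
      splits : ∀ s → L s → ∀ m → ∃ λ n → m ≤ n × L (s ∷ʳ n)
      splits s (state _ (revealed rv) ¬rv , _) m = contradiction rv ¬rv
      splits s (state ¬w (branching I infinite children) _ , e) m with infinite m
      ... | n , m≤n , i = n , m≤n , _ , trans (walk-∷ʳ s n e) (stepWith-T (I n) i)

    module Run (x : Baire) (x∈L : [ L ] x) where

      st : ℕ → State
      st k = proj₁ (x∈L k)

      transition : ∀ k → step (st k) (x k) ≡ just (st (suc k))
      transition k = trans (sym (walk-∷ʳ (x ↾ k) (x k) (proj₂ (x∈L k))))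
                           (trans (cong walk (applyUpTo-∷ʳ x k)) (proj₂ (x∈L (suc k))))

      moved : ∀ k → config (st k) ⟶[ x k ] config (st (suc k))
      moved k = step-⟶ (st k) (x k) (transition k)

      st-0 : st 0 ≡ restart root
      st-0 = just-injective (sym (proj₂ (x∈L 0)))

      ℓ : ℕ → ℕ
      ℓ k = length (t (st k))

      ℓ-0 : ℓ 0 ≡ 0
      ℓ-0 = cong (length ∘ t) st-0

      follows-x : ∀ k → s (st k) ++ u (st k) ≡ x ↾ k
      follows-x zero    = cong (λ σ → s σ ++ u σ) st-0
      follows-x (suc k) =
        trans (⟶-position (moved k)) (trans (cong (_∷ʳ x k) (follows-x k)) (applyUpTo-∷ʳ x k))

      lag : ∀ k → ℓ k ≤ length (s (st k))
      lag zero    = subst (λ σ → length (t σ) ≤ length (s σ)) (sym st-0) z≤n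
      lag (suc k) = ⟶-lag (moved k) (lag k)

      -- Well-foundedness of the rank forces a revelation, so the witness keeps growing.
      grows : ∀ {s t u} (r : Rank s t u) ¬w ¬rv k → st k ≡ state ¬w r ¬rv → ∃ λ k' → length t < ℓ k'
      grows (revealed rv) _ ¬rv _ _ = contradiction rv ¬rv
      grows {s} {t} {u} (branching I _ children) ¬w _ k e
        with stepWith-just (I (x k)) (subst (λ σ → step σ (x k) ≡ just (st (suc k))) e (transition k))
      ... | i , e' with em (Revealable s t (u ∷ʳ x k))
      ...   | yes (_ , m , _) = suc k , subst (λ σ → length t < length (State.t σ)) e'
                                              (≤-reflexive (sym (length-∷ʳ t m)))
      ...   | no  ¬rv'        = grows (children (x k) i) ¬w ¬rv' (suc k) (sym e')

      unbounded : ∀ j → ∃ λ k → j ≤ ℓ k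
      unbounded =
        growing⇒unbounded ℓ λ k → grows (rank (st k)) (unrefuted (st k)) (unrevealed (st k)) k refl

      witness : Σ Baire λ y → ∀ k → t (st k) ≡ y ↾ ℓ k
      witness = chain-limit (t ∘ st) (λ k → ⟶-extends (moved k)) (λ j → unbounded (suc j))

      y : Baire
      y = proj₁ witness

      along : Along x y
      along j with attains ℓ ℓ-0 (λ k → ⟶-length (moved k)) (proj₁ (unbounded j)) (proj₂ (unbounded j))
      ... | k , refl = subst S (zip-↾ x y k (follows-x k) (proj₂ witness k) (lag k))
                                (¬Refuted⇒S (unrefuted (st k)))

    L-within : ∀ x → [ L ] x → ∃ λ y → Along x y
    L-within x x∈L = Run.y x x∈L , Run.along x x∈L

theorem3 : ExcludedMiddle → (A : BaireSet) → IsAnalytic A →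
    (Σ SeqSet λ H → IsHechler H × (∀ x → [ H ] x → ¬ A x))
      ⊎ (Σ SeqSet λ L → IsLaver L × (∀ x → [ L ] x → A x))
theorem3 em A (S , A⇔) with em (Game.Refuted S [] [])
... | yes root = inj₁ (H , H-isHechler , λ x x∈H x∈A → H-avoids x x∈H (Equivalence.to (A⇔ x) x∈A))
  where open Game.HechlerSide S root
... | no ¬root = inj₂ (L , L-isLaver , λ x x∈L → Equivalence.from (A⇔ x) (L-within x x∈L))
  where open Game.LaverSide S em ¬root
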